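{- Let $i, n$ be integers with $1\le i\le n-1$. Then: (i) the map $(\pi_1,\pi_2)\mapsto \pi_1*\pi_2$ is a bijection from $\mathfrak{S}_i(1243,2143)\times\mathfrak{S}_{n-i}(1243,2143)$ onto the set of permutations $\pi \in \mathfrak{S}_n(1243,2143)$ with $\pi(i+1) = n$; (ii) for all $k\ge1$, all $\pi_1\in\mathfrak{S}_i(1243,2143)$ and all $\pi_2\in\mathfrak{S}_{n-i}(1243,2143)$, $$\tau_k(\pi_1*\pi_2) = \tau_k(\pi_1)+\tau_{k-1}(\pi_1)+\tau_k(\pi_2).$$
   Context: $\mathfrak{S}_n(1243,2143)$ is the set of permutations of $\{1,\dots,n\}$ with no subsequence having the same relative order as $1243$ or $2143$. For $k\ge1$, $\tau_k(\pi)$ is the number of increasing subsequences of length $k$ in $\pi$, and $\tau_0(\pi) = 0$. For nonempty permutations $\pi_1,\pi_2$ (written in one-line notation), let $\tilde\pi_1$ be the sequence obtained by adding $|\pi_2|-1$ to every entry of $\pi_1$ and then replacing the entry $|\pi_2|$ (the smallest entry of the result) by the first entry of $\pi_2$; let $\tilde\pi_2$ be $\pi_2$ with its first entry removed; then $\pi_1*\pi_2$ is the concatenation $\tilde\pi_1,\, N,\, \tilde\pi_2$ where $N = |\pi_1|+|\pi_2|$. (Example: $3124 * 15342 = 716895342$.) -}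

module Defs where

open import Data.Nat using (ℕ; zero; suc; _+_; _∸_; _<_; _≡ᵇ_)
open import Data.Bool using (if_then_else_)
open import Data.List using (List; []; _∷_; _++_; map; length; upTo; filter; lookup)
open import Data.List.Relation.Binary.Permutation.Propositional using (_↭_)
open import Data.List.Relation.Binary.Sublist.Propositional using (_⊆_)
open import Data.List.Relation.Unary.Linked using (Linked; linked?)
open import Data.Fin using (cast)
open import Data.Nat.Properties using (<-cmp)
open import Data.Product using (Σ; ∃; _×_)
open import Data.Maybe using (Maybe; just; nothing)
open import Relation.Binary.PropositionalEquality using (_≡_)
open import Relation.Nullary using (¬_)
open import Relation.Binary.Definitions using (tri<; tri≈; tri>)
open import Function.Bundles using (_⇔_)

-- Permutations of {1,…,n} in one-line notation are lists of naturals that are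
-- rearrangements of [1,2,…,n].
range : ℕ → List ℕ
range n = map suc (upTo n)

IsPerm : ℕ → List ℕ → Set
IsPerm n π = π ↭ range n

SameOrder : List ℕ → List ℕ → Set
SameOrder σ p = Σ (length σ ≡ length p) λ eq →
  ∀ a b → (lookup σ a < lookup σ b) ⇔ (lookup p (cast eq a) < lookup p (cast eq b))

Contains : List ℕ → List ℕ → Set
Contains p π = ∃ λ σ → σ ⊆ π × SameOrder σ p

p1243 p2143 : List ℕ
p1243 = 1 ∷ 2 ∷ 4 ∷ 3 ∷ []
p2143 = 2 ∷ 1 ∷ 4 ∷ 3 ∷ []

Av : ℕ → List ℕ → Set
Av n π = IsPerm n π × ¬ Contains p1243 π × ¬ Contains p2143 π

-- all subsequences (by choice of positions, with multiplicity)
subseqs : List ℕ → List (List ℕ)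
subseqs [] = [] ∷ []
subseqs (x ∷ xs) = map (x ∷_) (subseqs xs) ++ subseqs xs

-- τ_k(π): number of increasing subsequences of length k; τ_0 = 0
τ : ℕ → List ℕ → ℕ
τ zero π = 0
τ (suc k) π =
  length (filter (λ s → linked? (λ x y → x <? y) s) (filter (λ s → length s ≟ suc k) (subseqs π)))
  where
  open import Data.Nat using (_<?_; _≟_)

-- the * operation; the empty second argument is junk (never used)
_⋆_ : List ℕ → List ℕ → List ℕ
π₁ ⋆ [] = π₁
π₁ ⋆ (h ∷ t) = map f π₁ ++ (length π₁ + b) ∷ t
  where
  b = suc (length t)
  f : ℕ → ℕ
  f x = if (x + b ∸ 1) ≡ᵇ b then h else x + b ∸ 1

-- 0-indexed entry lookup
nth : List ℕ → ℕ → Maybe ℕ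
nth [] _ = nothing
nth (x ∷ xs) zero = just x
nth (x ∷ xs) (suc k) = nth xs k

module Submission where

-- Write π₁ ⋆ (h ∷ t) as L ++ N ∷ t, where L relabels π₁ by 1 ↦ h and x ↦ x + |t| (x ≥ 2), so that h is the
-- only entry of L that is ≤ |π₂|, and N is the maximum. An occurrence of 1243 or 2143 is a subsequence
-- w x y z with w, x < z < y. In π₁ ⋆ π₂ its entry z either exceeds |π₂|, which confines the occurrence to L,
-- or is at most |π₂|, which confines it to h ∷ t; so ⋆ preserves avoidance. Conversely, if π(i+1) = n, an
-- entry z > |π₂| after n would leave two entries ≤ |π₂| before n and w x n z would be an occurrence; hence the
-- entries after n, together with the unique entry h ≤ |π₂| before n, form π₂, and collapsing the prefix gives π₁.
-- An increasing subsequence of π₁ ⋆ π₂ lies in L, or is one in L followed by N, or meets t, or is N alone;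
-- these are counted by τ_k(π₁), τ_(k-1)(π₁) and (matching N alone with h alone) τ_k(π₂).

open import Data.Bool using (if_then_else_)
open import Data.Empty using (⊥; ⊥-elim)
open import Data.Fin using (Fin; zero; suc; cast)
open import Data.List using (List; []; _∷_; _++_; map; length; filter; applyUpTo; lookup)
open import Data.List.Membership.Propositional using (_∈_; find)
open import Data.List.Membership.Propositional.Properties using (∈-lookup; ∈-filter⁺; ∈-∃++)
open import Data.List.Properties
  using (length-map; length-++; map-∘; map-++; map-id-local; ++-assoc; ++-identityʳ; ∷-injective;
         filter-++; filter-all; filter-none; filter-accept; filter-reject; filter-notAll; filter-≐)
open import Data.List.Relation.Binary.Permutation.Propositional
  using (_↭_; ↭-refl; ↭-trans; ↭-sym; prep; ↭⇒↭ₛ; module PermutationReasoning)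
import Data.List.Relation.Binary.Permutation.Propositional.Properties as ↭
import Data.List.Relation.Binary.Permutation.Setoid.Properties as ↭ₛ
open import Data.List.Relation.Binary.Sublist.Propositional using (_⊆_; []; _∷_; _∷ʳ_; ⊆-refl; ⊆-trans; minimum; from∈)
import Data.List.Relation.Binary.Sublist.Propositional.Properties as ⊆
open import Data.List.Relation.Unary.All as All using (All; []; _∷_)
open import Data.List.Relation.Unary.All.Properties
  using (all-filter; ¬All⇒Any¬) renaming (map⁺ to All-map⁺; map⁻ to All-map⁻; ++⁺ to All-++⁺; ++⁻ to All-++⁻; ++⁻ʳ to All-++⁻ʳ)
open import Data.List.Relation.Unary.Any using (here; there)
open import Data.List.Relation.Unary.Linked using (Linked; []; [-]; _∷_; linked?)
open import Data.List.Relation.Unary.Linked.Properties using (Linked⇒All)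
open import Data.List.Relation.Unary.Unique.Propositional using (Unique; []; _∷_)
open import Data.Maybe using (just)
open import Data.Nat
open import Data.Nat.Properties
open import Algebra.Properties.CommutativeSemigroup +-commutativeSemigroup using (interchange)
open import Data.Nat.Solver using (module +-*-Solver)
open import Data.Product using (∃; ∃₂; _×_; _,_; proj₁; proj₂)
open import Data.Sum using (_⊎_; inj₁; inj₂)
import Data.Sum as Sum
open import Function using (_∘_)
open import Function.Bundles using (_⇔_; mk⇔; Equivalence)
open import Relation.Binary.Definitions using (tri<; tri≈; tri>)
open import Relation.Binary.PropositionalEquality
open import Relation.Nullary using (¬_; yes; no; _×-dec_)
open import Relation.Nullary.Decidable using (from-yes; dec-true; dec-false)
open import Relation.Unary using (Decidable)
open import Relation.Unary.Properties using (∁?)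

open import Defs

interval : ℕ → ℕ → List ℕ
interval a zero = []
interval a (suc m) = suc a ∷ interval (suc a) m

applyUpTo≡interval : ∀ (g : ℕ → ℕ) a m → (∀ k → g k ≡ a + k) → map suc (applyUpTo g m) ≡ interval a m
applyUpTo≡interval g a zero g≗ = refl
applyUpTo≡interval g a (suc m) g≗ = cong₂ _∷_ (cong suc (trans (g≗ 0) (+-identityʳ a)))
  (applyUpTo≡interval (g ∘ suc) (suc a) m (λ k → trans (g≗ (suc k)) (+-suc a k)))

range≡interval : ∀ n → range n ≡ interval 0 n
range≡interval n = applyUpTo≡interval (λ k → k) 0 n (λ _ → refl)

interval-++ : ∀ a m m′ → interval a (m + m′) ≡ interval a m ++ interval (a + m) m′
interval-++ a zero m′ = cong (λ b → interval b m′) (sym (+-identityʳ a))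
interval-++ a (suc m) m′ = cong (suc a ∷_)
  (trans (interval-++ (suc a) m m′) (cong (λ b → interval (suc a) m ++ interval b m′) (sym (+-suc a m))))

interval-∷ʳ : ∀ a m → interval a m ++ suc (a + m) ∷ [] ≡ interval a (suc m)
interval-∷ʳ a m = trans (sym (interval-++ a m 1)) (cong (interval a) (+-comm m 1))

length-interval : ∀ a m → length (interval a m) ≡ m
length-interval a zero = refl
length-interval a (suc m) = cong suc (length-interval (suc a) m)

interval-bounded : ∀ a m → All (λ x → a < x × x ≤ a + m) (interval a m)
interval-bounded a zero = []
interval-bounded a (suc m) = (≤-refl , subst (suc a ≤_) (sym (+-suc a m)) (s≤s (m≤m+n a m)))
  ∷ All.map (λ { {x} (1+a<x , x≤) → <⇒≤ 1+a<x , subst (x ≤_) (sym (+-suc a m)) x≤ }) (interval-bounded (suc a) m)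

interval-unique : ∀ a m → Unique (interval a m)
interval-unique a zero = []
interval-unique a (suc m) = All.map (λ (1+a<x , _) → <⇒≢ 1+a<x) (interval-bounded (suc a) m) ∷ interval-unique (suc a) m

∈-interval : ∀ a m {x} → a < x → x ≤ a + m → x ∈ interval a m
∈-interval a zero a<x x≤a+0 = ⊥-elim (<⇒≱ a<x (subst (_ ≤_) (+-identityʳ a) x≤a+0))
∈-interval a (suc m) {x} a<x x≤ with suc a ≟ x
... | yes refl = here refl
... | no 1+a≢x = there (∈-interval (suc a) m (≤∧≢⇒< a<x 1+a≢x) (subst (x ≤_) (+-suc a m) x≤))

filter-≤-interval : ∀ a m → filter (_≤? a) (interval 0 (a + m)) ≡ interval 0 a
filter-≤-interval a m = begin
  filter (_≤? a) (interval 0 (a + m))                             ≡⟨ cong (filter (_≤? a)) (interval-++ 0 a m) ⟩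
  filter (_≤? a) (interval 0 a ++ interval a m)                   ≡⟨ filter-++ (_≤? a) (interval 0 a) (interval a m) ⟩
  filter (_≤? a) (interval 0 a) ++ filter (_≤? a) (interval a m)  ≡⟨ cong₂ _++_ (filter-all (_≤? a) low) (filter-none (_≤? a) high) ⟩
  interval 0 a ++ []                                              ≡⟨ ++-identityʳ (interval 0 a) ⟩
  interval 0 a                                                    ∎
  where
  open ≡-Reasoning
  low = All.map proj₂ (interval-bounded 0 a)
  high = All.map (λ (a<x , _) → <⇒≱ a<x) (interval-bounded a m)

filter->-interval : ∀ a m → filter (∁? (_≤? a)) (interval 0 (a + m)) ≡ interval a m
filter->-interval a m = begin
  filter >a? (interval 0 (a + m))                         ≡⟨ cong (filter >a?) (interval-++ 0 a m) ⟩
  filter >a? (interval 0 a ++ interval a m)               ≡⟨ filter-++ >a? (interval 0 a) (interval a m) ⟩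
  filter >a? (interval 0 a) ++ filter >a? (interval a m)  ≡⟨ cong₂ _++_ (filter-none >a? low) (filter-all >a? high) ⟩
  interval a m                                            ∎
  where
  open ≡-Reasoning
  >a? = ∁? (_≤? a)
  low = All.map (λ (_ , x≤a) x≰a → x≰a x≤a) (interval-bounded 0 a)
  high = All.map (λ (a<x , _) → <⇒≱ a<x) (interval-bounded a m)

IsPerm⇒interval : ∀ {n π} → IsPerm n π → π ↭ interval 0 n
IsPerm⇒interval {n} p = subst (_ ↭_) (range≡interval n) p

IsPerm⇒length : ∀ {n π} → IsPerm n π → length π ≡ n
IsPerm⇒length {n} p = trans (↭.↭-length (IsPerm⇒interval p)) (length-interval 0 n)

IsPerm⇒Unique : ∀ {n π} → IsPerm n π → Unique π
IsPerm⇒Unique {n} p = ↭ₛ.Unique-resp-↭ (setoid ℕ) (↭⇒↭ₛ (↭-sym (IsPerm⇒interval p))) (interval-unique 0 n)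

IsPerm⇒bounded : ∀ {n π} → IsPerm n π → All (λ x → 1 ≤ x × x ≤ n) π
IsPerm⇒bounded {n} p = ↭.All-resp-↭ (↭-sym (IsPerm⇒interval p)) (interval-bounded 0 n)

IsPerm⇒positive : ∀ {n π} → IsPerm n π → All (1 ≤_) π
IsPerm⇒positive p = All.map proj₁ (IsPerm⇒bounded p)

IsPerm⇒head≤ : ∀ {n x xs} → IsPerm n (x ∷ xs) → x ≤ suc (length xs)
IsPerm⇒head≤ p with (_ , x≤n) ∷ _ ← IsPerm⇒bounded p = subst (_ ≤_) (sym (IsPerm⇒length p)) x≤n

IsPerm⇒∈ : ∀ {n π x} → IsPerm n π → 1 ≤ x → x ≤ n → x ∈ π
IsPerm⇒∈ {n} p 1≤x x≤n = ↭.∈-resp-↭ (↭-sym (IsPerm⇒interval p)) (∈-interval 0 n 1≤x x≤n)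

Unique-⊆ : ∀ {xs ys : List ℕ} → xs ⊆ ys → Unique ys → Unique xs
Unique-⊆ [] [] = []
Unique-⊆ (_ ∷ʳ xs⊆ys) (_ ∷ u) = Unique-⊆ xs⊆ys u
Unique-⊆ (refl ∷ xs⊆ys) (x∉ys ∷ u) = ⊆.All-resp-⊆ xs⊆ys x∉ys ∷ Unique-⊆ xs⊆ys u

Unique-++-∷ : ∀ xs {y : ℕ} {ys} → Unique (xs ++ y ∷ ys) → All (_≢ y) xs × All (y ≢_) ys
Unique-++-∷ [] (y∉ys ∷ _) = [] , y∉ys
Unique-++-∷ (x ∷ xs) (x∉ ∷ u) with xs≢y , y∉ys ← Unique-++-∷ xs u = All.head (All-++⁻ʳ xs x∉) ∷ xs≢y , y∉ys

Unique-≡⇒⊆[_] : ∀ (a : ℕ) {vs : List ℕ} → Unique vs → All (_≡ a) vs → vs ⊆ a ∷ []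
Unique-≡⇒⊆[ a ] [] [] = a ∷ʳ []
Unique-≡⇒⊆[ a ] _ (refl ∷ []) = refl ∷ []
Unique-≡⇒⊆[ a ] ((v≢v′ ∷ _) ∷ _) (refl ∷ refl ∷ _) = ⊥-elim (v≢v′ refl)

⊆-map⁻ : ∀ (g : ℕ → ℕ) {ws} xs → ws ⊆ map g xs → ∃ λ vs → vs ⊆ xs × map g vs ≡ ws
⊆-map⁻ g [] [] = [] , [] , refl
⊆-map⁻ g (x ∷ xs) (_ ∷ʳ ws⊆) with vs , vs⊆xs , refl ← ⊆-map⁻ g xs ws⊆ = vs , x ∷ʳ vs⊆xs , refl
⊆-map⁻ g (x ∷ xs) (refl ∷ ws⊆) with vs , vs⊆xs , refl ← ⊆-map⁻ g xs ws⊆ = x ∷ vs , refl ∷ vs⊆xs , refl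

⊆-++⁻ : ∀ L {R xs : List ℕ} → xs ⊆ L ++ R → ∃₂ λ xs₁ xs₂ → xs ≡ xs₁ ++ xs₂ × xs₁ ⊆ L × xs₂ ⊆ R
⊆-++⁻ [] xs⊆R = [] , _ , refl , [] , xs⊆R
⊆-++⁻ (a ∷ L) (_ ∷ʳ xs⊆) with xs₁ , xs₂ , refl , s₁ , s₂ ← ⊆-++⁻ L xs⊆ = xs₁ , xs₂ , refl , a ∷ʳ s₁ , s₂
⊆-++⁻ (a ∷ L) (refl ∷ xs⊆) with xs₁ , xs₂ , refl , s₁ , s₂ ← ⊆-++⁻ L xs⊆ = a ∷ xs₁ , xs₂ , refl , refl ∷ s₁ , s₂

++-injective : ∀ {xs ys as bs : List ℕ} → length xs ≡ length ys → xs ++ as ≡ ys ++ bs → xs ≡ ys × as ≡ bs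
++-injective {[]} {[]} _ eq = refl , eq
++-injective {x ∷ xs} {y ∷ ys} len eq with refl , eq′ ← ∷-injective eq
  with refl , as≡bs ← ++-injective {xs} {ys} (suc-injective len) eq′ = refl , as≡bs

map-≡⇒≡-at : ∀ {f g : ℕ → ℕ} {x xs} → x ∈ xs → map f xs ≡ map g xs → f x ≡ g x
map-≡⇒≡-at (here refl) eq = proj₁ (∷-injective eq)
map-≡⇒≡-at (there x∈xs) eq = map-≡⇒≡-at x∈xs (proj₂ (∷-injective eq))

lookup-map : ∀ (g : ℕ → ℕ) p (a : Fin (length (map g p))) → lookup (map g p) a ≡ g (lookup p (cast (length-map g p) a))
lookup-map g (x ∷ p) zero = refl
lookup-map g (x ∷ p) (suc a) = lookup-map g p a

nth-++-length : ∀ xs (v : ℕ) ys → nth (xs ++ v ∷ ys) (length xs) ≡ just v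
nth-++-length [] v ys = refl
nth-++-length (x ∷ xs) v ys = nth-++-length xs v ys

nth-split : ∀ π k {v} → nth π k ≡ just v → ∃₂ λ P T → π ≡ P ++ v ∷ T × length P ≡ k
nth-split (x ∷ π) zero refl = [] , π , refl , refl
nth-split (x ∷ π) (suc k) eq with P , T , refl , refl ← nth-split π k eq = x ∷ P , T , refl , refl

length≡1⇒singleton : ∀ {xs : List ℕ} → length xs ≡ 1 → ∃ λ x → xs ≡ x ∷ []
length≡1⇒singleton {x ∷ []} _ = x , refl

filter-map : ∀ {A B : Set} {P : B → Set} (P? : Decidable P) (f : A → B) xs →
             filter P? (map f xs) ≡ map f (filter (P? ∘ f) xs)
filter-map P? f [] = refl
filter-map P? f (x ∷ xs) with P? (f x)
... | yes _ = cong (f x ∷_) (filter-map P? f xs)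
... | no _ = filter-map P? f xs

filter-filter : ∀ {A : Set} {P Q : A → Set} (P? : Decidable P) (Q? : Decidable Q) xs →
                filter P? (filter Q? xs) ≡ filter (λ x → Q? x ×-dec P? x) xs
filter-filter P? Q? [] = refl
filter-filter P? Q? (x ∷ xs) with Q? x
... | no _ = filter-filter P? Q? xs
... | yes _ with P? x
...   | yes _ = cong (x ∷_) (filter-filter P? Q? xs)
...   | no _ = filter-filter P? Q? xs

↭-filter-∁ : ∀ {P : ℕ → Set} (P? : Decidable P) xs → xs ↭ filter P? xs ++ filter (∁? P?) xs
↭-filter-∁ P? [] = ↭-refl
↭-filter-∁ P? (x ∷ xs) with P? x
... | yes _ = prep x (↭-filter-∁ P? xs)
... | no _ = ↭-trans (prep x (↭-filter-∁ P? xs)) (↭-sym (↭.shift x (filter P? xs) (filter (∁? P?) xs)))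

two-of-filter : ∀ {P : ℕ → Set} (P? : Decidable P) xs → 2 ≤ length (filter P? xs) →
                ∃₂ λ w x → (w ∷ x ∷ []) ⊆ xs × P w × P x
two-of-filter P? xs 2≤ with filter P? xs | ⊆.filter-⊆ P? xs | all-filter P? xs
... | w ∷ x ∷ rest | s | pw ∷ px ∷ _ = w , x , ⊆-trans (refl ∷ refl ∷ minimum rest) s , pw , px
... | [] | _ | _ = ⊥-elim (<⇒≱ 2≤ z≤n)
... | _ ∷ [] | _ | _ = ⊥-elim (<⇒≱ 2≤ (s≤s z≤n))

mono-<⇔ : ∀ {Q : ℕ → Set} {g : ℕ → ℕ} → (∀ {u v} → Q u → Q v → u < v → g u < g v) →
          ∀ {u v} → Q u → Q v → g u < g v ⇔ u < v
mono-<⇔ {g = g} mono {u} {v} qu qv = mk⇔ reflect (mono qu qv)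
  where
  reflect : g u < g v → u < v
  reflect gu<gv with <-cmp u v
  ... | tri< u<v _ _ = u<v
  ... | tri≈ _ refl _ = ⊥-elim (<-irrefl refl gu<gv)
  ... | tri> _ _ v<u = ⊥-elim (<-asym gu<gv (mono qv qu v<u))

mono-from-step : ∀ {g : ℕ → ℕ} → (∀ {u} → 1 ≤ u → g u < g (suc u)) → ∀ {u v} → 1 ≤ u → u < v → g u < g v
mono-from-step step {u} {suc v} 1≤u (s≤s u≤v) with m≤n⇒m<n∨m≡n u≤v
... | inj₁ u<v = <-trans (mono-from-step step 1≤u u<v) (step (≤-trans 1≤u (<⇒≤ u<v)))
... | inj₂ refl = step 1≤u

sameOrder-map : ∀ (g : ℕ → ℕ) {Q : ℕ → Set} p → All Q p → (∀ {u v} → Q u → Q v → u < v → g u < g v) →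
                SameOrder (map g p) p
sameOrder-map g {Q} p qs mono = length-map g p , order
  where
  Q-at : ∀ a → Q (lookup p (cast (length-map g p) a))
  Q-at a = All.lookup qs (∈-lookup (cast (length-map g p) a))
  order : ∀ a b → lookup (map g p) a < lookup (map g p) b ⇔ lookup p (cast _ a) < lookup p (cast _ b)
  order a b rewrite lookup-map g p a | lookup-map g p b = mono-<⇔ mono (Q-at a) (Q-at b)

-- An occurrence w x y z of 1243 is the image of 1243 under stair w x z y (of 2143 under stair x w z y).
stair : ℕ → ℕ → ℕ → ℕ → ℕ → ℕ
stair a b c d 0 = a
stair a b c d 1 = a
stair a b c d 2 = b
stair a b c d 3 = c
stair a b c d (suc (suc (suc (suc k)))) = k + d

stair-mono : ∀ {a b c d} → a < b → b < c → c < d → ∀ {u v} → 1 ≤ u → u < v → stair a b c d u < stair a b c d v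
stair-mono {a} {b} {c} {d} a<b b<c c<d = mono-from-step step
  where
  step : ∀ {u} → 1 ≤ u → stair a b c d u < stair a b c d (suc u)
  step {1} _ = a<b
  step {2} _ = b<c
  step {3} _ = c<d
  step {suc (suc (suc (suc k)))} _ = n<1+n (k + d)

-- The patterns 1243 and 2143

-- The two patterns differ only in how their first two entries compare.
data Contains43 (π : List ℕ) : Set where
  occurrence : ∀ {w x y z} → (w ∷ x ∷ y ∷ z ∷ []) ⊆ π → w < z → x < z → z < y → Contains43 π

Contains43-⊆ : ∀ {xs ys} → xs ⊆ ys → Contains43 xs → Contains43 ys
Contains43-⊆ xs⊆ys (occurrence s w<z x<z z<y) = occurrence (⊆-trans s xs⊆ys) w<z x<z z<y

Contains43-map⁻ : ∀ {Q : ℕ → Set} (g : ℕ → ℕ) {xs} → All Q xs → (∀ {u v} → Q u → Q v → g u < g v → u < v) →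
                  Contains43 (map g xs) → Contains43 xs
Contains43-map⁻ g {xs} qs reflect (occurrence s w<z x<z z<y)
  with _ ∷ _ ∷ _ ∷ _ ∷ [] , s′ , refl ← ⊆-map⁻ g xs s
  with qw ∷ qx ∷ qy ∷ qz ∷ [] ← ⊆.All-resp-⊆ s′ qs
  = occurrence s′ (reflect qw qz w<z) (reflect qx qz x<z) (reflect qz qy z<y)

contains⇒Contains43 : ∀ {a b c d π} → a < c → b < c → c < d → Contains (a ∷ b ∷ d ∷ c ∷ []) π → Contains43 π
contains⇒Contains43 a<c b<c c<d (_ ∷ _ ∷ _ ∷ _ ∷ [] , s , _ , order) =
  occurrence s (from (order zero (suc (suc (suc zero)))) a<c)
               (from (order (suc zero) (suc (suc (suc zero)))) b<c)
               (from (order (suc (suc (suc zero))) (suc (suc zero))) c<d)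
  where open Equivalence
contains⇒Contains43 _ _ _ ([] , _ , () , _)
contains⇒Contains43 _ _ _ (_ ∷ [] , _ , () , _)
contains⇒Contains43 _ _ _ (_ ∷ _ ∷ [] , _ , () , _)
contains⇒Contains43 _ _ _ (_ ∷ _ ∷ _ ∷ [] , _ , () , _)
contains⇒Contains43 _ _ _ (_ ∷ _ ∷ _ ∷ _ ∷ _ ∷ _ , _ , () , _)

Contains43⇒contains : ∀ {π} → Unique π → Contains43 π → Contains p1243 π ⊎ Contains p2143 π
Contains43⇒contains u (occurrence {w} {x} {y} {z} s w<z x<z z<y) with <-cmp w x
... | tri< w<x _ _ = inj₁ (_ , s , sameOrder-map (stair w x z y) p1243 (from-yes (All.all? (1 ≤?_) p1243))
                                                  (λ 1≤u _ → stair-mono w<x x<z z<y 1≤u))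
... | tri> _ _ x<w = inj₂ (_ , s , sameOrder-map (stair x w z y) p2143 (from-yes (All.all? (1 ≤?_) p2143))
                                                  (λ 1≤u _ → stair-mono x<w w<z z<y 1≤u))
... | tri≈ _ w≡x _ with (w≢x ∷ _) ∷ _ ← Unique-⊆ s u = ⊥-elim (w≢x w≡x)

Av⇒¬Contains43 : ∀ {n π} → Av n π → ¬ Contains43 π
Av⇒¬Contains43 (perm , ¬1243 , ¬2143) c with Contains43⇒contains (IsPerm⇒Unique perm) c
... | inj₁ c1243 = ¬1243 c1243
... | inj₂ c2143 = ¬2143 c2143

¬Contains43⇒Av : ∀ {n π} → IsPerm n π → ¬ Contains43 π → Av n π
¬Contains43⇒Av perm ¬c =
  perm , ¬c ∘ contains⇒Contains43 (from-yes (1 <? 3)) (from-yes (2 <? 3)) (from-yes (3 <? 4))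
       , ¬c ∘ contains⇒Contains43 (from-yes (2 <? 3)) (from-yes (1 <? 3)) (from-yes (3 <? 4))

-- The relabelling used by ⋆

-- π₁ ⋆ (h ∷ t) unfolds to map (relabel h (length t)) π₁ ++ (length π₁ + suc (length t)) ∷ t.
relabel : ℕ → ℕ → ℕ → ℕ
relabel h l x = if (x + suc l ∸ 1) ≡ᵇ suc l then h else x + suc l ∸ 1

relabel-1 : ∀ h l → relabel h l 1 ≡ h
relabel-1 h l = cong (if_then h else suc l) (dec-true (l ≟ l) refl)

relabel-≥2 : ∀ h l {x} → 2 ≤ x → relabel h l x ≡ x + l
relabel-≥2 h l {suc (suc x)} (s≤s (s≤s z≤n)) =
  trans (cong (if_then h else suc (x + suc l)) (dec-false (x + suc l ≟ l) x+1+l≢l)) (cong suc (+-suc x l))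
  where
  x+1+l≢l : x + suc l ≢ l
  x+1+l≢l = ≢-sym (<⇒≢ (≤-trans (n<1+n l) (m≤n+m (suc l) x)))

relabel-large : ∀ {h l x} → 2 ≤ x → suc l < relabel h l x
relabel-large {h} {l} 2≤x = subst (suc l <_) (sym (relabel-≥2 h l 2≤x)) (+-monoˡ-≤ l 2≤x)

relabel-≤ : ∀ {h l x} → h ≤ suc l → 1 ≤ x → relabel h l x ≤ x + l
relabel-≤ {h} {l} {1} h≤1+l _ rewrite relabel-1 h l = h≤1+l
relabel-≤ {h} {l} {suc (suc x)} _ _ = ≤-reflexive (relabel-≥2 h l {suc (suc x)} (s≤s (s≤s z≤n)))

relabel-≤⇒1 : ∀ {h l x} → 1 ≤ x → relabel h l x ≤ suc l → x ≡ 1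
relabel-≤⇒1 {x = 1} _ _ = refl
relabel-≤⇒1 {h} {l} {suc (suc x)} _ x+l≤1+l = ⊥-elim (<⇒≱ (relabel-large {h} {l} (s≤s (s≤s z≤n))) x+l≤1+l)

relabel-mono : ∀ {h l x y} → h ≤ suc l → 1 ≤ x → x < y → relabel h l x < relabel h l y
relabel-mono {h} {l} {1} {y} h≤1+l _ 1<y rewrite relabel-1 h l = <-≤-trans (s≤s h≤1+l) (relabel-large 1<y)
relabel-mono {h} {l} {suc (suc x)} {y} _ _ x<y
  rewrite relabel-≥2 h l {suc (suc x)} (s≤s (s≤s z≤n)) | relabel-≥2 h l (<-trans (s≤s (s≤s z≤n)) x<y) = +-monoˡ-< l x<y

relabel-<⇔ : ∀ {h l x y} → h ≤ suc l → 1 ≤ x → 1 ≤ y → relabel h l x < relabel h l y ⇔ x < y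
relabel-<⇔ h≤1+l = mono-<⇔ (λ 1≤x _ → relabel-mono h≤1+l 1≤x)

relabel-around-1 : ∀ {h l} P Q → Unique (P ++ 1 ∷ Q) → All (1 ≤_) (P ++ 1 ∷ Q) →
                   All (suc l <_) (map (relabel h l) P) × All (suc l <_) (map (relabel h l) Q)
relabel-around-1 P Q u positive with P≢1 , 1∉Q ← Unique-++-∷ P u | 1≤P , _ ∷ 1≤Q ← All-++⁻ P positive =
  All-map⁺ (All.zipWith (λ (1≤x , x≢1) → relabel-large (≤∧≢⇒< 1≤x (≢-sym x≢1))) (1≤P , P≢1)) ,
  All-map⁺ (All.zipWith (λ (1≤x , 1≢x) → relabel-large (≤∧≢⇒< 1≤x 1≢x)) (1≤Q , 1∉Q))

map-relabel-< : ∀ {h l i xs} → h ≤ suc l → All (λ x → 1 ≤ x × x ≤ i) xs → All (_< i + suc l) (map (relabel h l) xs)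
map-relabel-< {h} {l} {i} h≤1+l bounded =
  All-map⁺ (All.map (λ (1≤x , x≤i) → ≤-<-trans (≤-trans (relabel-≤ h≤1+l 1≤x) (+-monoˡ-≤ l x≤i)) (+-monoʳ-< i (n<1+n l))) bounded)

map-relabel-interval : ∀ h l a m → 1 ≤ a → map (relabel h l) (interval a m) ≡ interval (a + l) m
map-relabel-interval h l a zero _ = refl
map-relabel-interval h l a (suc m) 1≤a =
  cong₂ _∷_ (relabel-≥2 h l (s≤s 1≤a)) (map-relabel-interval h l (suc a) m (≤-trans 1≤a (n≤1+n a)))

collapse : ℕ → ℕ → ℕ
collapse l x with x ≤? suc l
... | yes _ = 1
... | no _ = x ∸ l

collapse-≤ : ∀ {l x} → x ≤ suc l → collapse l x ≡ 1
collapse-≤ {l} {x} x≤1+l with x ≤? suc l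
... | yes _ = refl
... | no x≰1+l = ⊥-elim (x≰1+l x≤1+l)

collapse-> : ∀ {l x} → suc l < x → collapse l x ≡ x ∸ l
collapse-> {l} {x} 1+l<x with x ≤? suc l
... | yes x≤1+l = ⊥-elim (<⇒≱ 1+l<x x≤1+l)
... | no _ = refl

2≤∸ : ∀ {l x} → suc l < x → 2 ≤ x ∸ l
2≤∸ {l} {x} 1+l<x = subst (_≤ x ∸ l) (m+n∸n≡m 2 l) (∸-monoˡ-≤ l 1+l<x)

collapse-mono : ∀ {l x y} → x ≤ y → collapse l x ≤ collapse l y
collapse-mono {l} {x} {y} x≤y with x ≤? suc l | y ≤? suc l
... | yes _ | yes _ = ≤-refl
... | yes _ | no y≰1+l = ≤-trans (s≤s z≤n) (2≤∸ (≰⇒> y≰1+l))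
... | no x≰1+l | yes y≤1+l = ⊥-elim (x≰1+l (≤-trans x≤y y≤1+l))
... | no _ | no _ = ∸-monoˡ-≤ l x≤y

collapse-reflects-< : ∀ {l x y} → collapse l x < collapse l y → x < y
collapse-reflects-< c<c = ≰⇒> (λ y≤x → <⇒≱ c<c (collapse-mono y≤x))

collapse-relabel : ∀ {h l x} → h ≤ suc l → 1 ≤ x → collapse l (relabel h l x) ≡ x
collapse-relabel {h} {l} {1} h≤1+l _ rewrite relabel-1 h l = collapse-≤ h≤1+l
collapse-relabel {h} {l} {suc (suc x)} _ _ rewrite relabel-≥2 h l {suc (suc x)} (s≤s (s≤s z≤n)) =
  trans (collapse-> (s≤s (s≤s (m≤n+m l x)))) (m+n∸n≡m (suc (suc x)) l)

relabel-collapse : ∀ {h l x} → suc l < x → relabel h l (collapse l x) ≡ x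
relabel-collapse {h} {l} {x} 1+l<x rewrite collapse-> 1+l<x | relabel-≥2 h l (2≤∸ 1+l<x) =
  m∸n+n≡m (≤-trans (n≤1+n l) (<⇒≤ 1+l<x))

map-collapse-relabel : ∀ {h l xs} → h ≤ suc l → All (1 ≤_) xs → map (collapse l) (map (relabel h l) xs) ≡ xs
map-collapse-relabel h≤1+l [] = refl
map-collapse-relabel h≤1+l (1≤x ∷ positive) = cong₂ _∷_ (collapse-relabel h≤1+l 1≤x) (map-collapse-relabel h≤1+l positive)

map-collapse-interval : ∀ l k m → 1 ≤ k → map (collapse l) (interval (k + l) m) ≡ interval k m
map-collapse-interval l k zero _ = refl
map-collapse-interval l k (suc m) 1≤k =
  cong₂ _∷_ (trans (collapse-> (s≤s (+-monoˡ-≤ l 1≤k))) (m+n∸n≡m (suc k) l)) (map-collapse-interval l (suc k) m (s≤s z≤n))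

-- The bijection of part (i)

⋆-IsPerm : ∀ {π₁ h t} → 1 ≤ length π₁ → IsPerm (length π₁) π₁ → IsPerm (suc (length t)) (h ∷ t) →
           IsPerm (length π₁ + suc (length t)) (π₁ ⋆ (h ∷ t))
⋆-IsPerm {a ∷ as} {h} {t} _ perm₁ perm₂ = begin
  map f (a ∷ as) ++ N ∷ t                      ↭⟨ ↭.++⁺ʳ (N ∷ t) (↭.map⁺ f (IsPerm⇒interval perm₁)) ⟩
  map f (interval 0 (suc i)) ++ N ∷ t          ≡⟨ cong₂ (λ x xs → x ∷ xs ++ N ∷ t) (relabel-1 h l) (map-relabel-interval h l 1 i ≤-refl) ⟩
  h ∷ interval b i ++ N ∷ t                    ≡⟨ cong (h ∷_) (++-assoc (interval b i) (N ∷ []) t) ⟨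
  h ∷ (interval b i ++ N ∷ []) ++ t            ↭⟨ prep h (↭.++-comm (interval b i ++ N ∷ []) t) ⟩
  h ∷ t ++ interval b i ++ N ∷ []              ≡⟨ cong (λ x → h ∷ t ++ interval b i ++ suc x ∷ []) (+-comm i b) ⟩
  (h ∷ t) ++ interval b i ++ suc (b + i) ∷ []  ≡⟨ cong ((h ∷ t) ++_) (interval-∷ʳ b i) ⟩
  (h ∷ t) ++ interval b (suc i)                ↭⟨ ↭.++⁺ʳ (interval b (suc i)) (IsPerm⇒interval perm₂) ⟩
  interval 0 b ++ interval b (suc i)           ≡⟨ interval-++ 0 b (suc i) ⟨
  interval 0 (b + suc i)                       ≡⟨ cong (interval 0) (+-comm b (suc i)) ⟩
  interval 0 N                                 ≡⟨ range≡interval N ⟨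
  range N                                      ∎
  where
  open PermutationReasoning
  l = length t
  b = suc l
  i = length as
  N = suc i + b
  f = relabel h l

Contains43-++-max : ∀ {L t h b N} → (∀ {ws} → ws ⊆ L → All (_≤ b) ws → ws ⊆ h ∷ []) →
                    All (_< N) L → All (_≤ b) t → b < N →
                    Contains43 (L ++ N ∷ t) → Contains43 L ⊎ Contains43 (h ∷ t)
Contains43-++-max {L} {t} {h} {b} {N} small L<N t≤b b<N (occurrence {w} {x} {y} {z} s w<z x<z z<y) = split (⊆-++⁻ L s)
  where
  N≮ : ∀ {v} → v ≤ b → ¬ N < v
  N≮ v≤b N<v = <-irrefl refl (<-trans b<N (<-≤-trans N<v v≤b))
  last≤b : ∀ {u v} → (u ∷ v ∷ []) ⊆ N ∷ t → v ≤ b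
  last≤b (_ ∷ʳ s₂) with _ ∷ v≤b ∷ [] ← ⊆.All-resp-⊆ s₂ t≤b = v≤b
  last≤b (refl ∷ s₂) with v≤b ∷ [] ← ⊆.All-resp-⊆ s₂ t≤b = v≤b
  not-both-in-L : (w ∷ x ∷ []) ⊆ L → z ≤ b → ⊥
  not-both-in-L s₁ z≤b with small s₁ (<⇒≤ (<-≤-trans w<z z≤b) ∷ <⇒≤ (<-≤-trans x<z z≤b) ∷ [])
  ... | _ ∷ʳ ()
  ... | _ ∷ ()
  split : ∃₂ (λ xs₁ xs₂ → w ∷ x ∷ y ∷ z ∷ [] ≡ xs₁ ++ xs₂ × xs₁ ⊆ L × xs₂ ⊆ N ∷ t) → Contains43 L ⊎ Contains43 (h ∷ t)
  split ([] , _ , refl , _ , _ ∷ʳ s₂) = inj₂ (occurrence (h ∷ʳ s₂) w<z x<z z<y)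
  split ([] , _ , refl , _ , refl ∷ s₂) with _ ∷ _ ∷ z≤b ∷ [] ← ⊆.All-resp-⊆ s₂ t≤b = ⊥-elim (N≮ z≤b w<z)
  split (_ ∷ [] , _ , refl , s₁ , refl ∷ s₂) with _ ∷ z≤b ∷ [] ← ⊆.All-resp-⊆ s₂ t≤b = ⊥-elim (N≮ z≤b x<z)
  split (_ ∷ [] , _ , refl , s₁ , _ ∷ʳ s₂) with _ ∷ _ ∷ z≤b ∷ [] ← ⊆.All-resp-⊆ s₂ t≤b
    with refl ∷ [] ← small s₁ (<⇒≤ (<-≤-trans w<z z≤b) ∷ []) = inj₂ (occurrence (refl ∷ s₂) w<z x<z z<y)
  split (_ ∷ _ ∷ [] , _ , refl , s₁ , s₂) = ⊥-elim (not-both-in-L s₁ (last≤b s₂))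
  split (_ ∷ _ ∷ _ ∷ [] , _ , refl , s₁ , _ ∷ʳ s₂) with z≤b ∷ [] ← ⊆.All-resp-⊆ s₂ t≤b =
    ⊥-elim (not-both-in-L (⊆-trans (refl ∷ refl ∷ _ ∷ʳ []) s₁) z≤b)
  split (_ ∷ _ ∷ _ ∷ [] , _ , refl , s₁ , refl ∷ _) with _ ∷ _ ∷ y<N ∷ [] ← ⊆.All-resp-⊆ s₁ L<N = ⊥-elim (<-asym y<N z<y)
  split (_ ∷ _ ∷ _ ∷ _ ∷ [] , [] , refl , s₁ , _) = inj₁ (occurrence s₁ w<z x<z z<y)

relabel-small⊆[h] : ∀ {h l π₁ ws} → Unique π₁ → All (1 ≤_) π₁ →
                    ws ⊆ map (relabel h l) π₁ → All (_≤ suc l) ws → ws ⊆ h ∷ []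
relabel-small⊆[h] {h} {l} {π₁} u positive s ws≤1+l with vs , vs⊆π₁ , refl ← ⊆-map⁻ (relabel h l) π₁ s =
  subst (λ h′ → map (relabel h l) vs ⊆ h′ ∷ []) (relabel-1 h l) (⊆.map⁺ (relabel h l) (Unique-≡⇒⊆[ 1 ] (Unique-⊆ vs⊆π₁ u) ones))
  where
  ones : All (_≡ 1) vs
  ones = All.zipWith (λ (1≤v , fv≤1+l) → relabel-≤⇒1 {h} {l} 1≤v fv≤1+l) (⊆.All-resp-⊆ vs⊆π₁ positive , All-map⁻ ws≤1+l)

⋆-Contains43 : ∀ {π₁ h t} → 1 ≤ length π₁ → IsPerm (length π₁) π₁ → IsPerm (suc (length t)) (h ∷ t) →
               Contains43 (π₁ ⋆ (h ∷ t)) → Contains43 π₁ ⊎ Contains43 (h ∷ t)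
⋆-Contains43 {π₁} {h} {t} 1≤i perm₁ perm₂ =
  Sum.map₁ (Contains43-map⁻ (relabel h l) positive (λ 1≤u 1≤v → Equivalence.to (relabel-<⇔ h≤b 1≤u 1≤v)))
  ∘ Contains43-++-max (relabel-small⊆[h] (IsPerm⇒Unique perm₁) positive) (map-relabel-< h≤b (IsPerm⇒bounded perm₁))
                      (All.map proj₂ (All.tail (IsPerm⇒bounded perm₂))) (+-monoˡ-< (suc l) 1≤i)
  where
  l = length t
  h≤b = IsPerm⇒head≤ perm₂
  positive = IsPerm⇒positive perm₁

⋆-Av : ∀ {i m n π₁ π₂} → i + m ≡ n → 1 ≤ i → 1 ≤ m → Av i π₁ → Av m π₂ →
       Av n (π₁ ⋆ π₂) × nth (π₁ ⋆ π₂) i ≡ just n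
⋆-Av {π₂ = []} _ _ 1≤m _ (perm₂ , _) = ⊥-elim (<⇒≢ 1≤m (IsPerm⇒length perm₂))
⋆-Av {π₁ = π₁} {h ∷ t} refl 1≤i _ av₁@(perm₁ , _) av₂@(perm₂ , _)
  with refl ← IsPerm⇒length perm₁ | refl ← IsPerm⇒length perm₂ =
  ¬Contains43⇒Av (⋆-IsPerm 1≤i perm₁ perm₂) (Sum.[ Av⇒¬Contains43 av₁ , Av⇒¬Contains43 av₂ ] ∘ ⋆-Contains43 1≤i perm₁ perm₂) ,
  subst (λ k → nth (π₁ ⋆ (h ∷ t)) k ≡ just N) (length-map f π₁) (nth-++-length (map f π₁) N t)
  where
  f = relabel h (length t)
  N = length π₁ + suc (length t)

⋆-≡-split : ∀ {π₁ h t σ₁ h′ t′} → length π₁ ≡ length σ₁ → π₁ ⋆ (h ∷ t) ≡ σ₁ ⋆ (h′ ∷ t′) →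
            map (relabel h (length t)) π₁ ≡ map (relabel h′ (length t′)) σ₁ × t ≡ t′
⋆-≡-split {π₁} {h} {t} {σ₁} {h′} {t′} len eq
  with L≡L′ , N∷t≡N′∷t′ ← ++-injective {map (relabel h (length t)) π₁} {map (relabel h′ (length t′)) σ₁}
                                       (trans (length-map _ π₁) (trans len (sym (length-map _ σ₁)))) eq
  = L≡L′ , proj₂ (∷-injective N∷t≡N′∷t′)

⋆-injective : ∀ {i m π₁ π₂ σ₁ σ₂} → 1 ≤ i → 1 ≤ m → IsPerm i π₁ → IsPerm m π₂ → IsPerm i σ₁ → IsPerm m σ₂ →
              π₁ ⋆ π₂ ≡ σ₁ ⋆ σ₂ → π₁ ≡ σ₁ × π₂ ≡ σ₂
⋆-injective {π₂ = []} _ 1≤m _ perm₂ _ _ _ = ⊥-elim (<⇒≢ 1≤m (IsPerm⇒length perm₂))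
⋆-injective {π₂ = _ ∷ _} {σ₂ = []} _ 1≤m _ _ _ perm₂ _ = ⊥-elim (<⇒≢ 1≤m (IsPerm⇒length perm₂))
⋆-injective {π₁ = π₁} {h ∷ t} {σ₁} {h′ ∷ t′} 1≤i _ perm₁ perm₂ perm₁′ perm₂′ eq
  with L≡L′ , refl ← ⋆-≡-split (trans (IsPerm⇒length perm₁) (sym (IsPerm⇒length perm₁′))) eq = π₁≡σ₁ , cong (_∷ t) h≡h′
  where
  open ≡-Reasoning
  l = length t
  π₁≡σ₁ : π₁ ≡ σ₁
  π₁≡σ₁ = begin
    π₁                                        ≡⟨ map-collapse-relabel (IsPerm⇒head≤ perm₂) (IsPerm⇒positive perm₁) ⟨
    map (collapse l) (map (relabel h l) π₁)   ≡⟨ cong (map (collapse l)) L≡L′ ⟩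
    map (collapse l) (map (relabel h′ l) σ₁)  ≡⟨ map-collapse-relabel (IsPerm⇒head≤ perm₂′) (IsPerm⇒positive perm₁′) ⟩
    σ₁                                        ∎
  h≡h′ : h ≡ h′
  h≡h′ = begin
    h               ≡⟨ relabel-1 h l ⟨
    relabel h l 1   ≡⟨ map-≡⇒≡-at (IsPerm⇒∈ perm₁ ≤-refl 1≤i) (trans L≡L′ (cong (map (relabel h′ l)) (sym π₁≡σ₁))) ⟩
    relabel h′ l 1  ≡⟨ relabel-1 h′ l ⟩
    h′              ∎

module _ {p : ℕ} {P′ T : List ℕ}
         (av : Av (suc (length P′) + suc (length T)) ((p ∷ P′) ++ (suc (length P′) + suc (length T)) ∷ T)) where
  private
    P π : List ℕ
    i′ l b N : ℕ
    P = p ∷ P′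
    i′ = length P′
    l = length T
    b = suc l
    N = suc i′ + b
    π = P ++ N ∷ T

    perm : IsPerm N π
    perm = proj₁ av

    low? : Decidable (_≤ b)
    low? = _≤? b

    high? : Decidable (λ x → ¬ x ≤ b)
    high? = ∁? low?

    N≰b : ¬ N ≤ b
    N≰b = <⇒≱ (+-monoˡ-< b (s≤s z≤n))

    range≡interval-N : range N ≡ interval 0 (b + suc i′)
    range≡interval-N = trans (range≡interval N) (cong (interval 0) (+-comm (suc i′) b))

    low-perm : filter low? P ++ filter low? T ↭ interval 0 b
    low-perm = subst₂ _↭_ low-π low-range (↭.filter-↭ low? perm)
      where
      low-π : filter low? π ≡ filter low? P ++ filter low? T
      low-π = trans (filter-++ low? P (N ∷ T)) (cong (filter low? P ++_) (filter-reject low? N≰b))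
      low-range : filter low? (range N) ≡ interval 0 b
      low-range = trans (cong (filter low?) range≡interval-N) (filter-≤-interval b (suc i′))

    length-low : length (filter low? P) + length (filter low? T) ≡ b
    length-low = trans (sym (length-++ (filter low? P))) (trans (↭.↭-length low-perm) (length-interval 0 b))

    N∷T⊆π : N ∷ T ⊆ π
    N∷T⊆π = ⊆.++⁺ˡ P ⊆-refl

    T<N : All (_< N) T
    T<N with _ ∷ T-bounded ← ⊆.All-resp-⊆ N∷T⊆π (IsPerm⇒bounded perm)
           | N∉T ∷ _ ← Unique-⊆ N∷T⊆π (IsPerm⇒Unique perm)
      = All.zipWith (λ ((_ , x≤N) , N≢x) → ≤∧≢⇒< x≤N (≢-sym N≢x)) (T-bounded , N∉T)

    two-low : ¬ All (_≤ b) T → 2 ≤ length (filter low? P)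
    two-low T≰b = ≰⇒> λ lowP≤1 → <-irrefl length-low (+-mono-≤-< lowP≤1 (filter-notAll low? T (¬All⇒Any¬ low? T T≰b)))

    -- An entry z > b of T would leave two entries w, x ≤ b in P, and w x N z would be an occurrence.
    T≤b : All (_≤ b) T
    T≤b with All.all? low? T
    ... | yes T≤b = T≤b
    ... | no T≰b with z , z∈T , z≰b ← find (¬All⇒Any¬ low? T T≰b)
                 with w , x , wx⊆P , w≤b , x≤b ← two-of-filter low? P (two-low T≰b)
      = ⊥-elim (Av⇒¬Contains43 av (occurrence (⊆.++⁺ wx⊆P (refl ∷ from∈ z∈T))
                                               (≤-<-trans w≤b (≰⇒> z≰b)) (≤-<-trans x≤b (≰⇒> z≰b)) (All.lookup T<N z∈T)))

    the-low-entry : ∃ λ h → filter low? P ≡ h ∷ []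
    the-low-entry = length≡1⇒singleton (+-cancelʳ-≡ l _ 1 (trans (cong (λ xs → length (filter low? P) + length xs) (sym (filter-all low? T≤b))) length-low))

    h : ℕ
    h = proj₁ the-low-entry

    low-P≡[h] : filter low? P ≡ h ∷ []
    low-P≡[h] = proj₂ the-low-entry

    h≤b : h ≤ b
    h≤b with h≤b ∷ [] ← subst (All (_≤ b)) low-P≡[h] (all-filter low? P) = h≤b

    π₂-Av : Av b (h ∷ T)
    π₂-Av = ¬Contains43⇒Av π₂-perm (Av⇒¬Contains43 av ∘ Contains43-⊆ h∷T⊆π)
      where
      π₂-perm : IsPerm b (h ∷ T)
      π₂-perm = subst₂ _↭_ (cong₂ _++_ low-P≡[h] (filter-all low? T≤b)) (sym (range≡interval b)) low-perm
      h∷T⊆π : h ∷ T ⊆ π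
      h∷T⊆π = ⊆.++⁺ (subst (_⊆ P) low-P≡[h] (⊆.filter-⊆ low? P)) (N ∷ʳ ⊆-refl)

    high-perm : filter high? P ↭ interval b i′
    high-perm = subst₂ _↭_ (++-identityʳ _) (++-identityʳ _)
      (↭.drop-mid (filter high? P) (interval b i′) (subst₂ _↭_ high-π high-range (↭.filter-↭ high? perm)))
      where
      high-π : filter high? π ≡ filter high? P ++ N ∷ []
      high-π = trans (filter-++ high? P (N ∷ T)) (cong (filter high? P ++_)
        (trans (filter-accept high? N≰b) (cong (N ∷_) (filter-none high? (All.map (λ x≤b x≰b → x≰b x≤b) T≤b)))))
      high-range : filter high? (range N) ≡ interval b i′ ++ N ∷ []
      high-range = begin
        filter high? (range N)                  ≡⟨ cong (filter high?) range≡interval-N ⟩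
        filter high? (interval 0 (b + suc i′))  ≡⟨ filter->-interval b (suc i′) ⟩
        interval b (suc i′)                     ≡⟨ interval-∷ʳ b i′ ⟨
        interval b i′ ++ suc (b + i′) ∷ []      ≡⟨ cong (λ n → interval b i′ ++ suc n ∷ []) (+-comm b i′) ⟩
        interval b i′ ++ N ∷ []                 ∎
        where open ≡-Reasoning

    π₁ : List ℕ
    π₁ = map (collapse l) P

    π₁-Av : Av (suc i′) π₁
    π₁-Av = ¬Contains43⇒Av π₁-perm
      (Av⇒¬Contains43 av ∘ Contains43-⊆ (⊆.++⁺ʳ (N ∷ T) ⊆-refl) ∘ Contains43-map⁻ (collapse l) (All.universal-U P) (λ _ _ → collapse-reflects-<))
      where
      open PermutationReasoning
      π₁-perm : IsPerm (suc i′) π₁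
      π₁-perm = begin
        map (collapse l) P                                  ↭⟨ ↭.map⁺ (collapse l) (↭-filter-∁ low? P) ⟩
        map (collapse l) (filter low? P ++ filter high? P)  ≡⟨ cong (λ xs → map (collapse l) (xs ++ filter high? P)) low-P≡[h] ⟩
        map (collapse l) (h ∷ filter high? P)               ↭⟨ ↭.map⁺ (collapse l) (prep h high-perm) ⟩
        map (collapse l) (h ∷ interval b i′)                ≡⟨ cong₂ _∷_ (collapse-≤ h≤b) (map-collapse-interval l 1 i′ ≤-refl) ⟩
        interval 0 (suc i′)                                 ≡⟨ range≡interval (suc i′) ⟨
        range (suc i′)                                      ∎

    relabel-collapse-P : map (relabel h l) π₁ ≡ P
    relabel-collapse-P = trans (sym (map-∘ P)) (map-id-local (All.tabulate fixed))
      where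
      fixed : ∀ {x} → x ∈ P → relabel h l (collapse l x) ≡ x
      fixed {x} x∈P with ≤-<-connex x b
      ... | inj₂ b<x = relabel-collapse b<x
      ... | inj₁ x≤b with here refl ← subst (x ∈_) low-P≡[h] (∈-filter⁺ low? x∈P x≤b) =
        trans (cong (relabel h l) (collapse-≤ x≤b)) (relabel-1 h l)

  ⋆-split : ∃₂ λ π₁ π₂ → Av (suc i′) π₁ × Av b π₂ × π₁ ⋆ π₂ ≡ π
  ⋆-split = π₁ , h ∷ T , π₁-Av , π₂-Av , cong₂ (λ xs n → xs ++ n ∷ T) relabel-collapse-P (cong (_+ b) (length-map (collapse l) P))

⋆-surjective : ∀ {i m n π} → i + m ≡ n → 1 ≤ i → Av n π → nth π i ≡ just n →
               ∃₂ λ π₁ π₂ → Av i π₁ × Av m π₂ × π₁ ⋆ π₂ ≡ π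
⋆-surjective {i} {m} {π = π} refl 1≤i av nth≡ with nth-split π i nth≡
... | [] , _ , refl , refl = ⊥-elim (<⇒≱ 1≤i z≤n)
... | p ∷ P′ , T , refl , refl
  with refl ← +-cancelˡ-≡ (suc (length P′)) _ _ (trans (sym (length-++ (p ∷ P′))) (IsPerm⇒length (proj₁ av))) = ⋆-split av

-- Counting increasing subsequences

-- incFrom lo k xs counts the increasing subsequences of xs of length k with all entries ≥ lo.
-- Unlike τ 0, incFrom lo 0 xs = 1: it counts the empty subsequence.
incFrom : ℕ → ℕ → List ℕ → ℕ
incFrom lo zero xs = 1
incFrom lo (suc k) [] = 0
incFrom lo (suc k) (x ∷ xs) with lo ≤? x
... | yes _ = incFrom (suc x) k xs + incFrom lo (suc k) xs
... | no _ = incFrom lo (suc k) xs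

IncFrom : ℕ → ℕ → List ℕ → Set
IncFrom lo k s = length s ≡ k × Linked _<_ s × All (lo ≤_) s

IncFrom? : ∀ lo k → Decidable (IncFrom lo k)
IncFrom? lo k s = (length s ≟ k) ×-dec (linked? _<?_ s ×-dec All.all? (lo ≤?_) s)

IncFrom-∷ : ∀ {lo k x s} → IncFrom lo (suc k) (x ∷ s) ⇔ (lo ≤ x × IncFrom (suc x) k s)
IncFrom-∷ {lo} {k} {x} {s} = mk⇔ to from
  where
  to : IncFrom lo (suc k) (x ∷ s) → lo ≤ x × IncFrom (suc x) k s
  to (len , [-] , lo≤x ∷ _) = lo≤x , suc-injective len , [] , []
  to (len , x<y ∷ linked , lo≤x ∷ _) = lo≤x , suc-injective len , linked , Linked⇒All <-trans x<y linked
  cons : ∀ {s} → Linked _<_ s → All (x <_) s → Linked _<_ (x ∷ s)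
  cons [] [] = [-]
  cons linked (x<y ∷ _) = x<y ∷ linked
  from : lo ≤ x × IncFrom (suc x) k s → IncFrom lo (suc k) (x ∷ s)
  from (lo≤x , len , linked , x<s) = cong suc len , cons linked x<s , lo≤x ∷ All.map (≤-trans lo≤x ∘ <⇒≤) x<s

length-filter-subseqs-∷ : ∀ {P : List ℕ → Set} (P? : Decidable P) x xs →
  length (filter P? (subseqs (x ∷ xs))) ≡ length (filter (P? ∘ (x ∷_)) (subseqs xs)) + length (filter P? (subseqs xs))
length-filter-subseqs-∷ P? x xs = begin
  length (filter P? (map (x ∷_) (subseqs xs) ++ subseqs xs))
    ≡⟨ cong length (filter-++ P? (map (x ∷_) (subseqs xs)) (subseqs xs)) ⟩
  length (filter P? (map (x ∷_) (subseqs xs)) ++ filter P? (subseqs xs))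
    ≡⟨ length-++ (filter P? (map (x ∷_) (subseqs xs))) ⟩
  length (filter P? (map (x ∷_) (subseqs xs))) + length (filter P? (subseqs xs))
    ≡⟨ cong (λ ys → length ys + length (filter P? (subseqs xs))) (filter-map P? (x ∷_) (subseqs xs)) ⟩
  length (map (x ∷_) (filter (P? ∘ (x ∷_)) (subseqs xs))) + length (filter P? (subseqs xs))
    ≡⟨ cong (_+ length (filter P? (subseqs xs))) (length-map (x ∷_) (filter (P? ∘ (x ∷_)) (subseqs xs))) ⟩
  length (filter (P? ∘ (x ∷_)) (subseqs xs)) + length (filter P? (subseqs xs))
    ∎
  where open ≡-Reasoning

length-filter-IncFrom : ∀ lo k xs → length (filter (IncFrom? lo k) (subseqs xs)) ≡ incFrom lo k xs
length-filter-IncFrom lo zero [] = refl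
length-filter-IncFrom lo (suc k) [] = refl
length-filter-IncFrom lo zero (x ∷ xs) = trans (length-filter-subseqs-∷ (IncFrom? lo zero) x xs)
  (cong₂ _+_ (cong length (filter-none (IncFrom? lo zero ∘ (x ∷_)) (All.universal (λ { _ (() , _) }) (subseqs xs))))
             (length-filter-IncFrom lo zero xs))
length-filter-IncFrom lo (suc k) (x ∷ xs) with lo ≤? x
... | yes lo≤x = trans (length-filter-subseqs-∷ (IncFrom? lo (suc k)) x xs) (cong₂ _+_
  (trans (cong length (filter-≐ (IncFrom? lo (suc k) ∘ (x ∷_)) (IncFrom? (suc x) k)
                                ((λ inc → proj₂ (Equivalence.to IncFrom-∷ inc)) , (λ inc → Equivalence.from IncFrom-∷ (lo≤x , inc)))
                                (subseqs xs)))
         (length-filter-IncFrom (suc x) k xs))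
  (length-filter-IncFrom lo (suc k) xs))
... | no lo≰x = trans (length-filter-subseqs-∷ (IncFrom? lo (suc k)) x xs) (cong₂ _+_
  (cong length (filter-none (IncFrom? lo (suc k) ∘ (x ∷_))
                            (All.universal (λ _ inc → lo≰x (proj₁ (Equivalence.to IncFrom-∷ inc))) (subseqs xs))))
  (length-filter-IncFrom lo (suc k) xs))

τ-incFrom : ∀ k xs → τ (suc k) xs ≡ incFrom 0 (suc k) xs
τ-incFrom k xs = begin
  τ (suc k) xs
    ≡⟨ cong length (filter-filter _ _ (subseqs xs)) ⟩
  length (filter (λ s → (length s ≟ suc k) ×-dec linked? _<?_ s) (subseqs xs))
    ≡⟨ cong length (filter-≐ _ (IncFrom? 0 (suc k)) (to , from) (subseqs xs)) ⟩
  length (filter (IncFrom? 0 (suc k)) (subseqs xs))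
    ≡⟨ length-filter-IncFrom 0 (suc k) xs ⟩
  incFrom 0 (suc k) xs
    ∎
  where
  open ≡-Reasoning
  to : ∀ {s} → length s ≡ suc k × Linked _<_ s → IncFrom 0 (suc k) s
  to {s} (len , linked) = len , linked , All.universal (λ _ → z≤n) s
  from : ∀ {s} → IncFrom 0 (suc k) s → length s ≡ suc k × Linked _<_ s
  from (len , linked , _) = len , linked

τ-1 : ∀ xs → τ 1 xs ≡ length xs
τ-1 xs = trans (τ-incFrom 0 xs) (incFrom-0-1 xs)
  where
  incFrom-0-1 : ∀ xs → incFrom 0 1 xs ≡ length xs
  incFrom-0-1 [] = refl
  incFrom-0-1 (x ∷ xs) = cong suc (incFrom-0-1 xs)

incFrom-[] : ∀ lo lo′ k → incFrom lo k [] ≡ incFrom lo′ k []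
incFrom-[] lo lo′ zero = refl
incFrom-[] lo lo′ (suc k) = refl

incFrom-below : ∀ {lo} k {xs} → All (_< lo) xs → incFrom lo (suc k) xs ≡ 0
incFrom-below k [] = refl
incFrom-below {lo} k {x ∷ xs} (x<lo ∷ xs<lo) with lo ≤? x
... | yes lo≤x = ⊥-elim (<⇒≱ x<lo lo≤x)
... | no _ = incFrom-below k xs<lo

incFrom-lower : ∀ {lo} k {xs} → All (lo ≤_) xs → incFrom lo k xs ≡ incFrom 0 k xs
incFrom-lower zero _ = refl
incFrom-lower (suc k) [] = refl
incFrom-lower {lo} (suc k) {x ∷ xs} (lo≤x ∷ lo≤xs) with lo ≤? x
... | yes _ = cong (incFrom (suc x) k xs +_) (incFrom-lower (suc k) lo≤xs)
... | no lo≰x = ⊥-elim (lo≰x lo≤x)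

incFrom-map : ∀ {Q : ℕ → Set} (g : ℕ → ℕ) {lo lo′} k {xs} → All Q xs →
              (∀ {x y} → Q x → Q y → g x < g y ⇔ x < y) → (∀ {x} → Q x → lo′ ≤ g x ⇔ lo ≤ x) →
              incFrom lo′ k (map g xs) ≡ incFrom lo k xs
incFrom-map g zero _ _ _ = refl
incFrom-map g (suc k) [] _ _ = refl
incFrom-map g {lo} {lo′} (suc k) {x ∷ xs} (qx ∷ qs) order bound with lo′ ≤? g x | lo ≤? x
... | yes _ | yes _ = cong₂ _+_ (incFrom-map g k qs order (order qx)) (incFrom-map g (suc k) qs order bound)
... | no _ | no _ = incFrom-map g (suc k) qs order bound
... | yes lo′≤gx | no lo≰x = ⊥-elim (lo≰x (Equivalence.to (bound qx) lo′≤gx))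
... | no lo′≰gx | yes lo≤x = ⊥-elim (lo′≰gx (Equivalence.from (bound qx) lo≤x))

incFrom-relabel : ∀ {h l xs} j → h ≤ suc l → All (1 ≤_) xs → incFrom 0 j (map (relabel h l) xs) ≡ incFrom 0 j xs
incFrom-relabel {h} {l} j h≤1+l positive =
  incFrom-map (relabel h l) j positive (relabel-<⇔ h≤1+l) (λ _ → mk⇔ (λ _ → z≤n) (λ _ → z≤n))

incFrom-++-below : ∀ {lo} k xs {ys} → All (_< lo) ys → incFrom lo k (xs ++ ys) ≡ incFrom lo k xs
incFrom-++-below zero xs _ = refl
incFrom-++-below (suc k) [] ys<lo = incFrom-below k ys<lo
incFrom-++-below {lo} (suc k) (x ∷ xs) ys<lo with lo ≤? x
... | yes lo≤x = cong₂ _+_ (incFrom-++-below k xs (All.map (λ y<lo → ≤-trans y<lo (≤-trans lo≤x (n≤1+n x))) ys<lo))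
                           (incFrom-++-below (suc k) xs ys<lo)
... | no _ = incFrom-++-below (suc k) xs ys<lo

incFrom-++-descending : ∀ {lo m} k xs {ys} → All (m <_) xs → All (_≤ m) ys →
                        incFrom lo (suc k) (xs ++ ys) ≡ incFrom lo (suc k) xs + incFrom lo (suc k) ys
incFrom-++-descending k [] _ _ = refl
incFrom-++-descending {lo} k (x ∷ xs) {ys} (m<x ∷ m<xs) ys≤m with lo ≤? x
... | yes _ = trans (cong₂ _+_ (incFrom-++-below k xs (All.map (λ y≤m → s≤s (≤-trans y≤m (<⇒≤ m<x))) ys≤m))
                               (incFrom-++-descending k xs m<xs ys≤m))
                    (sym (+-assoc (incFrom (suc x) k xs) (incFrom lo (suc k) xs) (incFrom lo (suc k) ys)))
... | no _ = incFrom-++-descending k xs m<xs ys≤m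

incFrom-∷ʳ-max : ∀ {lo N} k xs → All (_< N) xs → lo ≤ N →
                 incFrom lo (suc k) (xs ++ N ∷ []) ≡ incFrom lo (suc k) xs + incFrom lo k xs
incFrom-∷ʳ-max {lo} {N} k [] [] lo≤N with lo ≤? N
... | yes _ = trans (+-identityʳ _) (incFrom-[] (suc N) lo k)
... | no lo≰N = ⊥-elim (lo≰N lo≤N)
incFrom-∷ʳ-max {lo} zero (x ∷ xs) (_ ∷ xs<N) lo≤N with lo ≤? x
... | yes _ = cong suc (incFrom-∷ʳ-max zero xs xs<N lo≤N)
... | no _ = incFrom-∷ʳ-max zero xs xs<N lo≤N
incFrom-∷ʳ-max {lo} (suc k) (x ∷ xs) (x<N ∷ xs<N) lo≤N with lo ≤? x
... | yes _ = trans (cong₂ _+_ (incFrom-∷ʳ-max k xs xs<N x<N) (incFrom-∷ʳ-max (suc k) xs xs<N lo≤N))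
                    (interchange (incFrom (suc x) (suc k) xs) (incFrom (suc x) k xs) (incFrom lo (suc (suc k)) xs) (incFrom lo (suc k) xs))
... | no _ = incFrom-∷ʳ-max (suc k) xs xs<N lo≤N

incFrom-max-then-below : ∀ {lo N} k xs {t} → All (_< N) xs → All (_< lo) t → lo ≤ N →
                         incFrom lo (suc k) (xs ++ N ∷ t) ≡ incFrom lo (suc k) xs + incFrom lo k xs
incFrom-max-then-below {lo} {N} k xs {t} xs<N t<lo lo≤N = begin
  incFrom lo (suc k) (xs ++ N ∷ t)          ≡⟨ cong (incFrom lo (suc k)) (++-assoc xs (N ∷ []) t) ⟨
  incFrom lo (suc k) ((xs ++ N ∷ []) ++ t)  ≡⟨ incFrom-++-below (suc k) (xs ++ N ∷ []) t<lo ⟩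
  incFrom lo (suc k) (xs ++ N ∷ [])         ≡⟨ incFrom-∷ʳ-max k xs xs<N lo≤N ⟩
  incFrom lo (suc k) xs + incFrom lo k xs   ∎
  where open ≡-Reasoning

incFrom-max-then-smaller : ∀ {lo m N} k xs {t} → All (m <_) xs → All (_< N) xs → m < N → All (_≤ m) t → lo ≤ suc m →
  incFrom lo (suc k) (xs ++ N ∷ t) ≡ incFrom 0 (suc k) xs + incFrom 0 k xs + incFrom lo (suc k) t
incFrom-max-then-smaller {lo} {m} {N} k xs {t} m<xs xs<N m<N t≤m lo≤1+m = begin
  incFrom lo (suc k) (xs ++ N ∷ t)
    ≡⟨ cong (incFrom lo (suc k)) (++-assoc xs (N ∷ []) t) ⟨
  incFrom lo (suc k) ((xs ++ N ∷ []) ++ t)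
    ≡⟨ incFrom-++-descending k (xs ++ N ∷ []) (All-++⁺ m<xs (m<N ∷ [])) t≤m ⟩
  incFrom lo (suc k) (xs ++ N ∷ []) + incFrom lo (suc k) t
    ≡⟨ cong (_+ incFrom lo (suc k) t) (incFrom-∷ʳ-max k xs xs<N (≤-trans lo≤1+m m<N)) ⟩
  incFrom lo (suc k) xs + incFrom lo k xs + incFrom lo (suc k) t
    ≡⟨ cong (_+ incFrom lo (suc k) t) (cong₂ _+_ (incFrom-lower (suc k) lo≤xs) (incFrom-lower k lo≤xs)) ⟩
  incFrom 0 (suc k) xs + incFrom 0 k xs + incFrom lo (suc k) t
    ∎
  where
  open ≡-Reasoning
  lo≤xs = All.map (≤-trans lo≤1+m) m<xs

incFrom-⋆-shape : ∀ {m N h t} K P Q → All (m <_) P → h ≤ m → All (m <_) Q → All (_< N) (P ++ h ∷ Q) → m < N → All (_≤ m) t →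
  incFrom 0 (2 + K) (P ++ h ∷ Q ++ N ∷ t) ≡ incFrom 0 (2 + K) (P ++ h ∷ Q) + incFrom 0 (suc K) (P ++ h ∷ Q) + incFrom 0 (2 + K) (h ∷ t)
incFrom-⋆-shape {m} {N} {h} {t} K [] Q [] h≤m m<Q (_ ∷ Q<N) m<N t≤m = begin
  incFrom (suc h) (suc K) (Q ++ N ∷ t) + incFrom 0 (2 + K) (Q ++ N ∷ t)
    ≡⟨ cong₂ _+_ (incFrom-max-then-smaller K Q m<Q Q<N m<N t≤m (s≤s h≤m)) (incFrom-max-then-smaller (suc K) Q m<Q Q<N m<N t≤m z≤n) ⟩
  (a + b + c) + (d + a + e)
    ≡⟨ solve 5 (λ a b c d e → (a :+ b :+ c) :+ (d :+ a :+ e) := (a :+ d) :+ (b :+ a) :+ (c :+ e)) refl a b c d e ⟩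
  (a + d) + (b + a) + (c + e)
    ≡⟨ cong₂ (λ a′ b′ → (a′ + d) + (b′ + a) + (c + e)) (incFrom-lower (suc K) h<Q) (incFrom-lower K h<Q) ⟨
  (incFrom (suc h) (suc K) Q + d) + (incFrom (suc h) K Q + a) + (c + e)
    ∎
  where
  open ≡-Reasoning
  open +-*-Solver
  h<Q = All.map (<-≤-trans (s≤s h≤m)) m<Q
  a = incFrom 0 (suc K) Q
  b = incFrom 0 K Q
  c = incFrom (suc h) (suc K) t
  d = incFrom 0 (2 + K) Q
  e = incFrom 0 (2 + K) t
incFrom-⋆-shape {m} {N} {h} {t} K (p ∷ P) Q (m<p ∷ m<P) h≤m m<Q (p<N ∷ L<N) m<N t≤m = begin
  incFrom (suc p) (suc K) (P ++ h ∷ Q ++ N ∷ t) + incFrom 0 (2 + K) (P ++ h ∷ Q ++ N ∷ t)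
    ≡⟨ cong₂ _+_ from-p (incFrom-⋆-shape K P Q m<P h≤m m<Q L<N m<N t≤m) ⟩
  (a + b) + (c + d + C)
    ≡⟨ solve 5 (λ a b c d C → (a :+ b) :+ (c :+ d :+ C) := (a :+ c) :+ (b :+ d) :+ C) refl a b c d C ⟩
  (a + c) + (b + d) + C
    ∎
  where
  open ≡-Reasoning
  open +-*-Solver
  L = P ++ h ∷ Q
  a = incFrom (suc p) (suc K) L
  b = incFrom (suc p) K L
  c = incFrom 0 (2 + K) L
  d = incFrom 0 (suc K) L
  C = incFrom 0 (2 + K) (h ∷ t)
  from-p : incFrom (suc p) (suc K) (P ++ h ∷ Q ++ N ∷ t) ≡ a + b
  from-p = trans (cong (incFrom (suc p) (suc K)) (sym (++-assoc P (h ∷ Q) (N ∷ t))))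
                 (incFrom-max-then-below K L L<N (All.map (λ y≤m → s≤s (≤-trans y≤m (<⇒≤ m<p))) t≤m) p<N)

τ₁-⋆ : ∀ π₁ h t → τ 1 (π₁ ⋆ (h ∷ t)) ≡ τ 1 π₁ + τ 0 π₁ + τ 1 (h ∷ t)
τ₁-⋆ π₁ h t = begin
  τ 1 (π₁ ⋆ (h ∷ t))                  ≡⟨ τ-1 (π₁ ⋆ (h ∷ t)) ⟩
  length (map f π₁ ++ N ∷ t)          ≡⟨ length-++ (map f π₁) ⟩
  length (map f π₁) + length (h ∷ t)  ≡⟨ cong (_+ length (h ∷ t)) (trans (length-map f π₁) (sym (+-identityʳ (length π₁)))) ⟩
  length π₁ + 0 + length (h ∷ t)      ≡⟨ cong₂ (λ a b → a + 0 + b) (τ-1 π₁) (τ-1 (h ∷ t)) ⟨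
  τ 1 π₁ + τ 0 π₁ + τ 1 (h ∷ t)       ∎
  where
  open ≡-Reasoning
  f = relabel h (length t)
  N = length π₁ + suc (length t)

τ-⋆ : ∀ {i m π₁ π₂} → 1 ≤ i → 1 ≤ m → IsPerm i π₁ → IsPerm m π₂ →
      ∀ k → τ (suc k) (π₁ ⋆ π₂) ≡ τ (suc k) π₁ + τ k π₁ + τ (suc k) π₂
τ-⋆ {π₂ = []} _ 1≤m _ perm₂ _ = ⊥-elim (<⇒≢ 1≤m (IsPerm⇒length perm₂))
τ-⋆ {π₁ = π₁} {h ∷ t} _ _ _ _ zero = τ₁-⋆ π₁ h t
τ-⋆ {π₁ = π₁} {h ∷ t} 1≤i _ perm₁ perm₂ (suc K)
  with refl ← IsPerm⇒length perm₁ | refl ← IsPerm⇒length perm₂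
  with P , Q , refl ← ∈-∃++ (IsPerm⇒∈ perm₁ ≤-refl 1≤i)
  with b<P′ , b<Q′ ← relabel-around-1 {h} {length t} P Q (IsPerm⇒Unique perm₁) (IsPerm⇒positive perm₁) = begin
  τ (2 + K) (π₁ ⋆ (h ∷ t))
    ≡⟨ τ-incFrom (suc K) (π₁ ⋆ (h ∷ t)) ⟩
  incFrom 0 (2 + K) (map f π₁ ++ N ∷ t)
    ≡⟨ cong (λ L → incFrom 0 (2 + K) (L ++ N ∷ t)) shape ⟩
  incFrom 0 (2 + K) ((P′ ++ h ∷ Q′) ++ N ∷ t)
    ≡⟨ cong (incFrom 0 (2 + K)) (++-assoc P′ (h ∷ Q′) (N ∷ t)) ⟩
  incFrom 0 (2 + K) (P′ ++ h ∷ Q′ ++ N ∷ t)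
    ≡⟨ incFrom-⋆-shape K P′ Q′ b<P′ h≤b b<Q′ (subst (All (_< N)) shape L<N) b<N t≤b ⟩
  incFrom 0 (2 + K) (P′ ++ h ∷ Q′) + incFrom 0 (suc K) (P′ ++ h ∷ Q′) + C
    ≡⟨ cong (λ L → incFrom 0 (2 + K) L + incFrom 0 (suc K) L + C) shape ⟨
  incFrom 0 (2 + K) (map f π₁) + incFrom 0 (suc K) (map f π₁) + C
    ≡⟨ cong₂ (λ a b → a + b + C) (incFrom-relabel (2 + K) h≤b positive) (incFrom-relabel (suc K) h≤b positive) ⟩
  incFrom 0 (2 + K) π₁ + incFrom 0 (suc K) π₁ + C
    ≡⟨ cong₂ _+_ (cong₂ _+_ (τ-incFrom (suc K) π₁) (τ-incFrom K π₁)) (τ-incFrom (suc K) (h ∷ t)) ⟨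
  τ (2 + K) π₁ + τ (suc K) π₁ + τ (2 + K) (h ∷ t)
    ∎
  where
  open ≡-Reasoning
  l = length t
  N = length π₁ + suc l
  f = relabel h l
  P′ = map f P
  Q′ = map f Q
  C = incFrom 0 (2 + K) (h ∷ t)
  shape : map f π₁ ≡ P′ ++ h ∷ Q′
  shape = trans (map-++ f P (1 ∷ Q)) (cong (λ x → P′ ++ x ∷ Q′) (relabel-1 h l))
  h≤b = IsPerm⇒head≤ perm₂
  t≤b = All.map proj₂ (All.tail (IsPerm⇒bounded perm₂))
  b<N = +-monoˡ-< (suc l) 1≤i
  L<N = map-relabel-< h≤b (IsPerm⇒bounded perm₁)
  positive = IsPerm⇒positive perm₁

proposition3p6 : (i n : ℕ) → 1 ≤ i → i < n →
    ((∀ π₁ π₂ → Av i π₁ → Av (n ∸ i) π₂ → Av n (π₁ ⋆ π₂) × nth (π₁ ⋆ π₂) i ≡ just n)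
     × (∀ π₁ π₂ σ₁ σ₂ → Av i π₁ → Av (n ∸ i) π₂ → Av i σ₁ → Av (n ∸ i) σ₂ →
          π₁ ⋆ π₂ ≡ σ₁ ⋆ σ₂ → π₁ ≡ σ₁ × π₂ ≡ σ₂)
     × (∀ π → Av n π → nth π i ≡ just n →
          ∃₂ λ π₁ π₂ → Av i π₁ × Av (n ∸ i) π₂ × π₁ ⋆ π₂ ≡ π))
    × (∀ k → 1 ≤ k → ∀ π₁ π₂ → Av i π₁ → Av (n ∸ i) π₂ →
         τ k (π₁ ⋆ π₂) ≡ τ k π₁ + τ (k ∸ 1) π₁ + τ k π₂)
proposition3p6 i n 1≤i i<n =
  ( (λ _ _ av₁ av₂ → ⋆-Av i+m≡n 1≤i 1≤m av₁ av₂)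
  , (λ _ _ _ _ av₁ av₂ av₁′ av₂′ → ⋆-injective 1≤i 1≤m (proj₁ av₁) (proj₁ av₂) (proj₁ av₁′) (proj₁ av₂′))
  , (λ _ av nth≡n → ⋆-surjective i+m≡n 1≤i av nth≡n) )
  , λ { (suc k) _ _ _ av₁ av₂ → τ-⋆ 1≤i 1≤m (proj₁ av₁) (proj₁ av₂) k }
  where
  i+m≡n : i + (n ∸ i) ≡ n
  i+m≡n = m+[n∸m]≡n (<⇒≤ i<n)
  1≤m : 1 ≤ n ∸ i
  1≤m = m<n⇒0<n∸m i<n
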